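{- Let $\mathcal{P}$ be a finite poset and let $\mathcal{A},\mathcal{B}$ be antichains of $\mathcal{L}(\mathcal{P})$. For any $p\in\mathcal{P}$ define $\mathcal{A}^p_1=\{A\setminus{\downarrow}p\mid A\in\mathcal{A}\}$, $\mathcal{B}^p_1=\{B\setminus{\downarrow}p\mid B\in\mathcal{B},\ p\in B\}$, $\mathcal{A}^p_2=\{A\mid A\in\mathcal{A},\ p\notin A\}$, $\mathcal{B}^p_2=\{B\setminus{\uparrow}p\mid B\in\mathcal{B}\}$. Then for any $p\in\mathcal{P}$, $\mathcal{A}$ and $\mathcal{B}$ are dual in $\mathcal{L}(\mathcal{P})$ if and only if $\mathcal{A}^p_1$ and $\mathcal{B}^p_1$ are dual in $\mathcal{L}(\mathcal{P}\setminus{\downarrow}p)$ and $\mathcal{A}^p_2$ and $\mathcal{B}^p_2$ are dual in $\mathcal{L}(\mathcal{P}\setminus{\uparrow}p)$.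
   Context: For a finite poset $\mathcal{P}$, $\mathcal{L}(\mathcal{P})$ denotes the distributive lattice of all downsets (order ideals) of $\mathcal{P}$ ordered by inclusion; for a subset $Q\subseteq\mathcal{P}$, $\mathcal{L}(Q)$ is the lattice of downsets of $Q$ with the induced order. ${\downarrow}p$ is the smallest downset containing $p$ and ${\uparrow}p$ the smallest upset containing $p$. Antichains $\mathcal{A},\mathcal{B}$ of a lattice satisfy (*) if $A\not\subseteq B$ for all $A\in\mathcal{A}$, $B\in\mathcal{B}$; they are dual if they satisfy (*) and for every element $X$ of the lattice there is $A\in\mathcal{A}$ with $A\subseteq X$ or $B\in\mathcal{B}$ with $X\subseteq B$. -}

module Defs where

open import Level using (0ℓ)
open import Data.Nat using (ℕ)
open import Data.Fin using (Fin)
open import Data.Fin.Subset using (Subset; _∈_; _∉_; _⊆_; _⊈_; _─_)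
open import Data.Vec using (tabulate)
open import Data.Product using (Σ; _×_; ∃; ∃-syntax)
open import Data.Sum using (_⊎_)
open import Relation.Nullary using (¬_; does)
open import Relation.Unary using (Pred)
open import Relation.Binary using (Rel; Decidable; IsPartialOrder)
open import Relation.Binary.PropositionalEquality using (_≡_)

record FinPoset (n : ℕ) : Set₁ where
  field
    _≼_            : Rel (Fin n) 0ℓ
    isPartialOrder : IsPartialOrder _≡_ _≼_
    _≼?_           : Decidable _≼_

Family : ℕ → Set₁
Family n = Pred (Subset n) 0ℓ

module _ {n : ℕ} (P : FinPoset n) where
  open FinPoset P

  down : Fin n → Subset n
  down p = tabulate (λ x → does (x ≼? p))

  up : Fin n → Subset n
  up p = tabulate (λ x → does (p ≼? x))

  full : Subset n
  full = tabulate (λ _ → Data.Bool.true)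
    where import Data.Bool

  -- X is an element of L(Q): a downset of Q with the induced order
  IsDownsetIn : Subset n → Subset n → Set
  IsDownsetIn Q X = X ⊆ Q × (∀ {x y} → x ∈ Q → y ∈ Q → x ≼ y → y ∈ X → x ∈ X)

  IsAntichainIn : Subset n → Family n → Set
  IsAntichainIn Q 𝒜 =
    (∀ A → 𝒜 A → IsDownsetIn Q A) ×
    (∀ A B → 𝒜 A → 𝒜 B → A ⊆ B → A ≡ B)

  Star : Family n → Family n → Set
  Star 𝒜 ℬ = ∀ A B → 𝒜 A → ℬ B → A ⊈ B

  DualIn : Subset n → Family n → Family n → Set
  DualIn Q 𝒜 ℬ =
    Star 𝒜 ℬ ×
    (∀ X → IsDownsetIn Q X →
       (∃[ A ] (𝒜 A × A ⊆ X)) ⊎ (∃[ B ] (ℬ B × X ⊆ B)))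

  A₁ : Fin n → Family n → Family n
  A₁ p 𝒜 X = ∃[ A ] (𝒜 A × X ≡ A ─ down p)

  B₁ : Fin n → Family n → Family n
  B₁ p ℬ X = ∃[ B ] (ℬ B × p ∈ B × X ≡ B ─ down p)

  A₂ : Fin n → Family n → Family n
  A₂ p 𝒜 X = 𝒜 X × p ∉ X

  B₂ : Fin n → Family n → Family n
  B₂ p ℬ X = ∃[ B ] (ℬ B × X ≡ B ─ up p)

-- A downset X of P is split by p: if p ∈ X then ↓p ⊆ X, so X is determined by X ─ ↓p
-- and inclusions involving it can be tested in L(P ─ ↓p); if p ∉ X then X avoids ↑p
-- and lives in L(P ─ ↑p).  Conversely a downset X of P ─ ↓p is seen in L(P) as X ∪ ↓p,
-- and P ─ ↑p is itself a downset of P.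
module Submission where

open import Data.Empty using (⊥-elim)
open import Data.Fin using (Fin)
open import Data.Fin.Subset using (Subset; _∈_; _∉_; _⊆_; _∪_; _─_; inside; outside)
open import Data.Fin.Subset.Properties
  using (_∈?_; ⊆-trans; x∈p∪q⁻; x∈p∪q⁺; p⊆p∪q; q⊆p∪q; x∈p∧x∉q⇒x∈p─q; p─q⊆p)
open import Data.Nat using (ℕ)
open import Data.Product using (_×_; _,_; proj₁; ∃-syntax)
open import Data.Sum as Sum using (_⊎_; inj₁; inj₂)
open import Data.Vec using (_∷_; tabulate; here; there)
open import Data.Vec.Properties using ([]=⇒lookup; lookup⇒[]=; lookup∘tabulate)
open import Function.Base using (_∘_)
open import Function.Bundles using (_⇔_; mk⇔)
open import Relation.Binary using (IsPartialOrder)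
open import Relation.Binary.PropositionalEquality using (refl; sym; trans)
open import Relation.Nullary using (does; yes; no)
open import Relation.Nullary.Decidable using (dec-true)
open import Relation.Unary using (Pred; Decidable)

open import Defs

private
  variable
    n : ℕ
    x : Fin n
    p q r s : Subset n

x∈p─q⇒x∉q : ∀ (p q : Subset n) → x ∈ p ─ q → x ∉ q
x∈p─q⇒x∉q (inside  ∷ p) (outside ∷ q) here      = λ ()
x∈p─q⇒x∉q (_       ∷ p) (_       ∷ q) (there m) (there m′) = x∈p─q⇒x∉q p q m m′

p⊆q⇒p─r⊆q─r : p ⊆ q → p ─ r ⊆ q ─ r
p⊆q⇒p─r⊆q─r {p = p} {r = r} p⊆q x∈ =
  x∈p∧x∉q⇒x∈p─q (p⊆q (p─q⊆p p r x∈)) (x∈p─q⇒x∉q p r x∈)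

r⊆q∧p─r⊆q─r⇒p⊆q : r ⊆ q → p ─ r ⊆ q ─ r → p ⊆ q
r⊆q∧p─r⊆q─r⇒p⊆q {r = r} {q = q} r⊆q p─r⊆q─r {x} x∈p with x ∈? r
... | yes x∈r = r⊆q x∈r
... | no  x∉r = p─q⊆p q r (p─r⊆q─r (x∈p∧x∉q⇒x∈p─q x∈p x∉r))

p⊆q∪r⇒p─r⊆q : p ⊆ q ∪ r → p ─ r ⊆ q
p⊆q∪r⇒p─r⊆q {p = p} {q = q} {r = r} p⊆q∪r x∈ with x∈p∪q⁻ q r (p⊆q∪r (p─q⊆p p r x∈))
... | inj₁ x∈q = x∈q
... | inj₂ x∈r = ⊥-elim (x∈p─q⇒x∉q p r x∈ x∈r)

p⊆q∧p⊆s─r⇒p⊆q─r : p ⊆ q → p ⊆ s ─ r → p ⊆ q ─ r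
p⊆q∧p⊆s─r⇒p⊆q─r {s = s} {r = r} p⊆q p⊆s─r x∈ =
  x∈p∧x∉q⇒x∈p─q (p⊆q x∈) (x∈p─q⇒x∉q s r (p⊆s─r x∈))

module _ {ℓ} {R : Pred (Fin n) ℓ} (R? : Decidable R) where

  ∈-tabulate-does⁺ : R x → x ∈ tabulate (does ∘ R?)
  ∈-tabulate-does⁺ {x} r = lookup⇒[]= x _ (trans (lookup∘tabulate _ x) (dec-true (R? x) r))

  ∈-tabulate-does⁻ : x ∈ tabulate (does ∘ R?) → R x
  ∈-tabulate-does⁻ {x} m with R? x | trans (sym (lookup∘tabulate _ x)) ([]=⇒lookup m)
  ... | yes r | _ = r

module _ (P : FinPoset n) where
  open FinPoset P
  private module ≼ = IsPartialOrder isPartialOrder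

  IsDownset : Subset n → Set
  IsDownset = IsDownsetIn P (full P)

  Covers : Subset n → Family n → Family n → Set
  Covers Q 𝒜 ℬ = ∀ X → IsDownsetIn P Q X → (∃[ A ] (𝒜 A × A ⊆ X)) ⊎ (∃[ B ] (ℬ B × X ⊆ B))

  ∈full : x ∈ full P
  ∈full {x = x} = lookup⇒[]= x _ (lookup∘tabulate _ x)

  ∈down⁺ : ∀ {a} → x ≼ a → x ∈ down P a
  ∈down⁺ {a = a} = ∈-tabulate-does⁺ (_≼? a)

  ∈down⁻ : ∀ {a} → x ∈ down P a → x ≼ a
  ∈down⁻ {a = a} = ∈-tabulate-does⁻ (_≼? a)

  ∈up⁺ : ∀ {a} → a ≼ x → x ∈ up P a
  ∈up⁺ {a = a} = ∈-tabulate-does⁺ (a ≼?_)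

  ∈up⁻ : ∀ {a} → x ∈ up P a → a ≼ x
  ∈up⁻ {a = a} = ∈-tabulate-does⁻ (a ≼?_)

  IsDownsetIn-─ : ∀ {Q X} D → IsDownsetIn P Q X → IsDownsetIn P (Q ─ D) (X ─ D)
  IsDownsetIn-─ {Q} {X} D (X⊆Q , X↓) =
    p⊆q⇒p─r⊆q─r X⊆Q ,
    λ x∈Q─D y∈Q─D x≼y y∈X─D →
      x∈p∧x∉q⇒x∈p─q
        (X↓ (p─q⊆p Q D x∈Q─D) (p─q⊆p Q D y∈Q─D) x≼y (p─q⊆p X D y∈X─D))
        (x∈p─q⇒x∉q Q D x∈Q─D)

  IsDownsetIn-trans : ∀ {R Q X} → IsDownsetIn P R Q → IsDownsetIn P Q X → IsDownsetIn P R X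
  IsDownsetIn-trans (Q⊆R , Q↓) (X⊆Q , X↓) =
    ⊆-trans X⊆Q Q⊆R ,
    λ x∈R y∈R x≼y y∈X → X↓ (Q↓ x∈R y∈R x≼y (X⊆Q y∈X)) (X⊆Q y∈X) x≼y y∈X

  IsDownsetIn-restrict : ∀ {Q Q′ X} → Q′ ⊆ Q → X ⊆ Q′ → IsDownsetIn P Q X → IsDownsetIn P Q′ X
  IsDownsetIn-restrict Q′⊆Q X⊆Q′ (_ , X↓) =
    X⊆Q′ , λ x∈Q′ y∈Q′ → X↓ (Q′⊆Q x∈Q′) (Q′⊆Q y∈Q′)

  module _ (a : Fin n) where

    down⊆ : ∀ {X} → IsDownset X → a ∈ X → down P a ⊆ X
    down⊆ (_ , X↓) a∈X x∈↓a = X↓ ∈full ∈full (∈down⁻ x∈↓a) a∈X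

    ⊆full─up : ∀ {X} → IsDownset X → a ∉ X → X ⊆ full P ─ up P a
    ⊆full─up (_ , X↓) a∉X x∈X =
      x∈p∧x∉q⇒x∈p─q ∈full (λ x∈↑a → a∉X (X↓ ∈full ∈full (∈up⁻ x∈↑a) x∈X))

    full─up-isDownset : IsDownset (full P ─ up P a)
    full─up-isDownset =
      p─q⊆p (full P) (up P a) ,
      λ _ _ x≼y y∈ → x∈p∧x∉q⇒x∈p─q ∈full
        (λ x∈↑a → x∈p─q⇒x∉q (full P) (up P a) y∈ (∈up⁺ (≼.trans (∈up⁻ x∈↑a) x≼y)))

    ∪down-isDownset : ∀ {X} → IsDownsetIn P (full P ─ down P a) X → IsDownset (X ∪ down P a)
    ∪down-isDownset {X} (X⊆Q , X↓) = (λ _ → ∈full) , λ _ _ → step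
      where
      step : ∀ {x y} → x ≼ y → y ∈ X ∪ down P a → x ∈ X ∪ down P a
      step {x} x≼y y∈ with x∈p∪q⁻ X (down P a) y∈ | x ≼? a
      ... | inj₂ y∈↓a | _      = x∈p∪q⁺ (inj₂ (∈down⁺ (≼.trans x≼y (∈down⁻ y∈↓a))))
      ... | inj₁ _    | yes x≼a = x∈p∪q⁺ (inj₂ (∈down⁺ x≼a))
      ... | inj₁ y∈X  | no  x⋠a =
        x∈p∪q⁺ (inj₁ (X↓ (x∈p∧x∉q⇒x∈p─q ∈full (x⋠a ∘ ∈down⁻)) (X⊆Q y∈X) x≼y y∈X))

    module _ {𝒜 ℬ : Family n} where

      star⇒star₂ : Star P 𝒜 ℬ → Star P (A₂ P a 𝒜) (B₂ P a ℬ)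
      star⇒star₂ ⋆ A _ (A∈ , _) (B , B∈ , refl) A⊆B─ =
        ⋆ A B A∈ B∈ (⊆-trans A⊆B─ (p─q⊆p B (up P a)))

      covers⇒covers₁ : Covers (full P) 𝒜 ℬ → Covers (full P ─ down P a) (A₁ P a 𝒜) (B₁ P a ℬ)
      covers⇒covers₁ cov X X↓ =
        Sum.map
          (λ { (A , A∈ , A⊆) → A ─ down P a , (A , A∈ , refl) , p⊆q∪r⇒p─r⊆q A⊆ })
          (λ { (B , B∈ , ⊆B) →
                 B ─ down P a , (B , B∈ , ⊆B (q⊆p∪q X (down P a) (∈down⁺ ≼.refl)) , refl) ,
                 p⊆q∧p⊆s─r⇒p⊆q─r (⊆-trans (p⊆p∪q (down P a)) ⊆B) (proj₁ X↓) })
          (cov (X ∪ down P a) (∪down-isDownset X↓))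

      covers⇒covers₂ : Covers (full P) 𝒜 ℬ → Covers (full P ─ up P a) (A₂ P a 𝒜) (B₂ P a ℬ)
      covers⇒covers₂ cov X X↓ =
        Sum.map
          (λ { (A , A∈ , A⊆X) → A , (A∈ , a∉Q ∘ proj₁ X↓ ∘ A⊆X) , A⊆X })
          (λ { (B , B∈ , X⊆B) → B ─ up P a , (B , B∈ , refl) , p⊆q∧p⊆s─r⇒p⊆q─r X⊆B (proj₁ X↓) })
          (cov X (IsDownsetIn-trans full─up-isDownset X↓))
        where
        a∉Q : a ∉ full P ─ up P a
        a∉Q a∈ = x∈p─q⇒x∉q (full P) (up P a) a∈ (∈up⁺ ≼.refl)

      module _ (ℬ↓ : ∀ B → ℬ B → IsDownset B) where

        star⇒star₁ : Star P 𝒜 ℬ → Star P (A₁ P a 𝒜) (B₁ P a ℬ)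
        star⇒star₁ ⋆ _ _ (A , A∈ , refl) (B , B∈ , a∈B , refl) A─⊆B─ =
          ⋆ A B A∈ B∈ (r⊆q∧p─r⊆q─r⇒p⊆q (down⊆ (ℬ↓ B B∈) a∈B) A─⊆B─)

        star₁×star₂⇒star : Star P (A₁ P a 𝒜) (B₁ P a ℬ) → Star P (A₂ P a 𝒜) (B₂ P a ℬ) →
                           Star P 𝒜 ℬ
        star₁×star₂⇒star ⋆₁ ⋆₂ A B A∈ B∈ A⊆B with a ∈? B
        ... | yes a∈B = ⋆₁ _ _ (A , A∈ , refl) (B , B∈ , a∈B , refl) (p⊆q⇒p─r⊆q─r A⊆B)
        ... | no  a∉B = ⋆₂ A _ (A∈ , a∉B ∘ A⊆B) (B , B∈ , refl)
                          (p⊆q∧p⊆s─r⇒p⊆q─r A⊆B (⊆-trans A⊆B (⊆full─up (ℬ↓ B B∈) a∉B)))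

        covers₁×covers₂⇒covers : Covers (full P ─ down P a) (A₁ P a 𝒜) (B₁ P a ℬ) →
                                 Covers (full P ─ up P a) (A₂ P a 𝒜) (B₂ P a ℬ) →
                                 Covers (full P) 𝒜 ℬ
        covers₁×covers₂⇒covers cov₁ cov₂ X X↓ with a ∈? X
        ... | yes a∈X =
          Sum.map
            (λ { (_ , (A , A∈ , refl) , ⊆) → A , A∈ , r⊆q∧p─r⊆q─r⇒p⊆q (down⊆ X↓ a∈X) ⊆ })
            (λ { (_ , (B , B∈ , a∈B , refl) , ⊆) →
                   B , B∈ , r⊆q∧p─r⊆q─r⇒p⊆q (down⊆ (ℬ↓ B B∈) a∈B) ⊆ })
            (cov₁ (X ─ down P a) (IsDownsetIn-─ (down P a) X↓))
        ... | no a∉X =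
          Sum.map
            (λ { (A , (A∈ , _) , A⊆X) → A , A∈ , A⊆X })
            (λ { (_ , (B , B∈ , refl) , X⊆B─) → B , B∈ , ⊆-trans X⊆B─ (p─q⊆p B (up P a)) })
            (cov₂ X (IsDownsetIn-restrict (p─q⊆p (full P) (up P a)) (⊆full─up X↓ a∉X) X↓))

lemma3 : {n : ℕ} (P : FinPoset n) (𝒜 ℬ : Family n) →
    IsAntichainIn P (full P) 𝒜 → IsAntichainIn P (full P) ℬ →
    (p : Fin n) →
    DualIn P (full P) 𝒜 ℬ ⇔
      (DualIn P (full P ─ down P p) (A₁ P p 𝒜) (B₁ P p ℬ) ×
       DualIn P (full P ─ up P p) (A₂ P p 𝒜) (B₂ P p ℬ))
lemma3 P 𝒜 ℬ _ (ℬ↓ , _) p = mk⇔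
  (λ (⋆ , cov) → (star⇒star₁ P p ℬ↓ ⋆ , covers⇒covers₁ P p cov) ,
                 (star⇒star₂ P p ⋆ , covers⇒covers₂ P p cov))
  (λ ((⋆₁ , cov₁) , (⋆₂ , cov₂)) →
     star₁×star₂⇒star P p ℬ↓ ⋆₁ ⋆₂ , covers₁×covers₂⇒covers P p ℬ↓ cov₁ cov₂)
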